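{- Let $q$ be a positive integer with $\varphi(q)\geq 4$, where $\varphi$ is Euler's totient function. Then there exists an integer $a$ with $1\leq a\leq q-1$ and $\gcd(a,q)=1$ such that $a/q$ has a finite simple continued fraction expansion $a/q=[a_1,\ldots,a_n]$ with positive integer partial quotients satisfying: $n\geq 2$; $a_1\geq 2$ and $a_n\geq 2$; and $\max(a_1,\ldots,a_n)\leq \frac{q-1}{2}$.
   Context: $[a_1,\ldots,a_n]$ denotes the finite simple continued fraction $\cfrac{1}{a_1+\cfrac{1}{a_2+\cdots+\cfrac{1}{a_n}}}$ with positive integers $a_i$. -}

module Defs where

open import Data.Nat using (ℕ; zero; suc; _+_; _*_; _≤_)
open import Data.Nat.GCD using (gcd)
open import Data.Nat.Coprimality using (coprime?)
open import Data.List using (List; []; _∷_; filter; upTo; length)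
open import Data.Product using (_×_; _,_)

φ : ℕ → ℕ
φ q = length (filter (λ k → coprime? (suc k) q) (upTo q))

-- Value of the finite simple continued fraction
--   [a₁,…,aₙ] = 1/(a₁ + 1/(a₂ + ⋯ + 1/aₙ))
-- represented as a fraction (numerator , denominator).
-- [] ↦ 0/1 and [a₁, rest] = 1/(a₁ + p/r) = r/(a₁ r + p) where rest = p/r.
cf : List ℕ → ℕ × ℕ
cf [] = 0 , 1
cf (a ∷ as) with cf as
... | p , r = r , a * r + p

_/_≡cf_ : ℕ → ℕ → List ℕ → Set
x / y ≡cf as with cf as
... | p , r = x * r ≡ p * y
  where open import Relation.Binary.PropositionalEquality using (_≡_)

{-# OPTIONS --safe #-}
module Submission where

open import Defs
open import Data.Nat using (ℕ; suc; _+_; _*_; _∸_; _⊔_; _≤_; z≤n; s≤s)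
open import Data.Nat.Properties
  using (+-identityʳ; *-zeroʳ; *-distribˡ-⊔; ⊔-lub; ≤-reflexive; ≤-trans; m≤m+n; m≤n*m;
         +-monoʳ-≤; *-monoˡ-≤; m+n≤o⇒m≤o; m+n≤o⇒m≤o∸n; module ≤-Reasoning)
open import Data.Nat.Divisibility using (∣m+n∣m⇒∣n; ∣n⇒∣m*n)
open import Data.Nat.Coprimality using (Coprime; coprime⇒gcd≡1; 1-coprimeTo)
import Data.Nat.Coprimality as Coprimality
open import Data.Nat.GCD using (gcd)
open import Data.Nat.Tactic.RingSolver using (solve-∀)
open import Data.List using (List; []; _∷_; length; head; last; foldr)
open import Data.List.Relation.Unary.All using (All; []; _∷_)
open import Data.Maybe.Relation.Unary.All as MaybeAll using ()
open import Data.Product using (Σ; _×_; _,_; proj₁; proj₂)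
open import Relation.Binary.PropositionalEquality using (_≡_; refl; sym; cong)

-- An odd q = 2m + 1 ≥ 5 takes a = m, as m/(2m + 1) = [2, m]. An even q takes the odd one of
-- q/2 − 1 and q/2 − 2 for a, and then a/q = [2, k, 2], [2, k, 4] or [2, k, 1, 3] according
-- to q mod 8 (except 3/10 = [3, 3]). The numerator and denominator of a continued fraction
-- are always coprime, and a < q as soon as a₁ ≥ 2, so for each family only the denominator
-- and the size of the partial quotients need checking.

numerator denominator : List ℕ → ℕ
numerator   as = proj₁ (cf as)
denominator as = proj₂ (cf as)

cf-coprime : ∀ as → Coprime (numerator as) (denominator as)
cf-coprime []       = Coprimality.sym (1-coprimeTo 0)
cf-coprime (a ∷ as) (d∣r , d∣ar+p) =
  cf-coprime as (∣m+n∣m⇒∣n d∣ar+p (∣n⇒∣m*n a d∣r) , d∣r)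

denominator-positive : ∀ {as} → All (1 ≤_) as → 1 ≤ denominator as
denominator-positive []                       = s≤s z≤n
denominator-positive {a ∷ as} (s≤s z≤n ∷ ps) =
  ≤-trans (denominator-positive ps) (≤-trans (m≤n*m (denominator as) a) (m≤m+n _ _))

numerator<denominator : ∀ {a as} → 2 ≤ a → All (1 ≤_) as → numerator (a ∷ as) + 1 ≤ denominator (a ∷ as)
numerator<denominator {a} {as} 2≤a ps = begin
  r + 1      ≤⟨ +-monoʳ-≤ r (denominator-positive ps) ⟩
  r + r      ≡⟨ cong (r +_) (sym (+-identityʳ r)) ⟩
  2 * r      ≤⟨ *-monoˡ-≤ r 2≤a ⟩
  a * r      ≤⟨ m≤m+n _ _ ⟩
  a * r + numerator as ∎
  where
  open ≤-Reasoning
  r = denominator as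

*-max-lub : ∀ c {n} as → All (λ x → c * x ≤ n) as → c * foldr _⊔_ 0 as ≤ n
*-max-lub c []       []         rewrite *-zeroʳ c = z≤n
*-max-lub c (x ∷ xs) (cx≤n ∷ ps) rewrite *-distribˡ-⊔ c x (foldr _⊔_ 0 xs) =
  ⊔-lub cx≤n (*-max-lub c xs ps)

record Admissible (q : ℕ) : Set where
  field
    quotients     : List ℕ
    positive      : All (1 ≤_) quotients
    length≥2      : 2 ≤ length quotients
    first≥2       : MaybeAll.All (2 ≤_) (head quotients)
    last≥2        : MaybeAll.All (2 ≤_) (last quotients)
    doubled≤q-1   : All (λ x → 2 * x ≤ q ∸ 1) quotients
    denominator≡q : denominator quotients ≡ q

GoodFraction : ℕ → Set
GoodFraction q = Σ ℕ λ a → Σ (List ℕ) λ as →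
  1 ≤ a × a ≤ q ∸ 1 × gcd a q ≡ 1 ×
  All (1 ≤_) as × a / q ≡cf as ×
  2 ≤ length as ×
  MaybeAll.All (2 ≤_) (head as) × MaybeAll.All (2 ≤_) (last as) ×
  2 * foldr _⊔_ 0 as ≤ q ∸ 1

admissible⇒goodFraction : ∀ {q} → Admissible q → GoodFraction q
admissible⇒goodFraction record
  { quotients = as@(a ∷ as′) ; positive = ps@(_ ∷ ps′) ; length≥2 = length≥2
  ; first≥2 = MaybeAll.just 2≤a ; last≥2 = last≥2 ; doubled≤q-1 = bounds ; denominator≡q = refl } =
  numerator as , as ,
  denominator-positive ps′ ,
  m+n≤o⇒m≤o∸n (numerator as) (numerator<denominator 2≤a ps′) ,
  coprime⇒gcd≡1 (cf-coprime as) ,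
  ps , refl , length≥2 , MaybeAll.just 2≤a , last≥2 ,
  *-max-lub 2 as bounds

≤-via-+ : ∀ {x z} y → x + y ≡ z → x ≤ z
≤-via-+ {x} y eq = m+n≤o⇒m≤o x (≤-reflexive eq)

2≤2+ : ∀ {k} → 2 ≤ 2 + k
2≤2+ = s≤s (s≤s z≤n)

odd-admissible : ∀ m → Admissible (5 + m * 2)
odd-admissible m = record
  { quotients     = 2 ∷ 2 + m ∷ []
  ; positive      = s≤s z≤n ∷ s≤s z≤n ∷ []
  ; length≥2      = 2≤2+
  ; first≥2       = MaybeAll.just 2≤2+
  ; last≥2        = MaybeAll.just 2≤2+
  ; doubled≤q-1   = m≤m+n 4 _ ∷ ≤-reflexive (bound m) ∷ []
  ; denominator≡q = denominator≡ m
  }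
  where
  -- Each denominator≡ states denominator quotients ≡ q with the left side unfolded, as the
  -- solver does not unfold cf.
  bound : ∀ m → 2 * (2 + m) ≡ 4 + m * 2
  bound = solve-∀
  denominator≡ : ∀ m → 2 * ((2 + m) * 1 + 0) + 1 ≡ 5 + m * 2
  denominator≡ = solve-∀

multipleOf4-admissible : ∀ k → Admissible (8 + k * 4)
multipleOf4-admissible k = record
  { quotients     = 2 ∷ 1 + k ∷ 2 ∷ []
  ; positive      = s≤s z≤n ∷ s≤s z≤n ∷ s≤s z≤n ∷ []
  ; length≥2      = 2≤2+
  ; first≥2       = MaybeAll.just 2≤2+
  ; last≥2        = MaybeAll.just 2≤2+
  ; doubled≤q-1   = m≤m+n 4 _ ∷ ≤-via-+ (5 + k * 2) (bound k) ∷ m≤m+n 4 _ ∷ []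
  ; denominator≡q = denominator≡ k
  }
  where
  bound : ∀ k → 2 * (1 + k) + (5 + k * 2) ≡ 7 + k * 4
  bound = solve-∀
  denominator≡ : ∀ k → 2 * ((1 + k) * 2 + 1) + 2 ≡ 8 + k * 4
  denominator≡ = solve-∀

2mod8-admissible : ∀ k → Admissible (18 + k * 8)
2mod8-admissible k = record
  { quotients     = 2 ∷ 1 + k ∷ 1 ∷ 3 ∷ []
  ; positive      = s≤s z≤n ∷ s≤s z≤n ∷ s≤s z≤n ∷ s≤s z≤n ∷ []
  ; length≥2      = 2≤2+
  ; first≥2       = MaybeAll.just 2≤2+
  ; last≥2        = MaybeAll.just 2≤2+
  ; doubled≤q-1   = m≤m+n 4 _ ∷ ≤-via-+ (15 + k * 6) (bound k) ∷ m≤m+n 2 _ ∷ m≤m+n 6 _ ∷ []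
  ; denominator≡q = denominator≡ k
  }
  where
  bound : ∀ k → 2 * (1 + k) + (15 + k * 6) ≡ 17 + k * 8
  bound = solve-∀
  denominator≡ : ∀ k → 2 * ((1 + k) * 4 + 3) + 4 ≡ 18 + k * 8
  denominator≡ = solve-∀

6mod8-admissible : ∀ k → Admissible (14 + k * 8)
6mod8-admissible k = record
  { quotients     = 2 ∷ 1 + k ∷ 4 ∷ []
  ; positive      = s≤s z≤n ∷ s≤s z≤n ∷ s≤s z≤n ∷ []
  ; length≥2      = 2≤2+
  ; first≥2       = MaybeAll.just 2≤2+
  ; last≥2        = MaybeAll.just 2≤2+
  ; doubled≤q-1   = m≤m+n 4 _ ∷ ≤-via-+ (11 + k * 6) (bound k) ∷ m≤m+n 8 _ ∷ []
  ; denominator≡q = denominator≡ k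
  }
  where
  bound : ∀ k → 2 * (1 + k) + (11 + k * 6) ≡ 13 + k * 8
  bound = solve-∀
  denominator≡ : ∀ k → 2 * ((1 + k) * 4 + 1) + 4 ≡ 14 + k * 8
  denominator≡ = solve-∀

10-admissible : Admissible 10
10-admissible = record
  { quotients     = 3 ∷ 3 ∷ []
  ; positive      = s≤s z≤n ∷ s≤s z≤n ∷ []
  ; length≥2      = 2≤2+
  ; first≥2       = MaybeAll.just 2≤2+
  ; last≥2        = MaybeAll.just 2≤2+
  ; doubled≤q-1   = m≤m+n 6 _ ∷ m≤m+n 6 _ ∷ []
  ; denominator≡q = refl
  }

data Residue : ℕ → Set where
  odd         : ∀ m → Residue (1 + m * 2)
  multipleOf4 : ∀ k → Residue (k * 4)
  2mod8       : ∀ k → Residue (2 + k * 8)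
  6mod8       : ∀ k → Residue (6 + k * 8)

residue : ∀ q → Residue q
residue 0 = multipleOf4 0
residue 1 = odd 0
residue 2 = 2mod8 0
residue 3 = odd 1
residue 4 = multipleOf4 1
residue 5 = odd 2
residue 6 = 6mod8 0
residue 7 = odd 3
residue (suc (suc (suc (suc (suc (suc (suc (suc q)))))))) with residue q
... | odd m         = odd (4 + m)
... | multipleOf4 k = multipleOf4 (2 + k)
... | 2mod8 k       = 2mod8 (1 + k)
... | 6mod8 k       = 6mod8 (1 + k)

admissible : ∀ {q} → Residue q → 4 ≤ φ q → Admissible q
admissible (odd 0)                     (s≤s ())
admissible (odd 1)                     (s≤s (s≤s ()))
admissible (odd (suc (suc m)))         _ = odd-admissible m
admissible (multipleOf4 0)             ()
admissible (multipleOf4 1)             (s≤s (s≤s ()))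
admissible (multipleOf4 (suc (suc k))) _ = multipleOf4-admissible k
admissible (2mod8 0)                   (s≤s ())
admissible (2mod8 1)                   _ = 10-admissible
admissible (2mod8 (suc (suc k)))       _ = 2mod8-admissible k
admissible (6mod8 0)                   (s≤s (s≤s ()))
admissible (6mod8 (suc k))             _ = 6mod8-admissible k

proposition1 : (q : ℕ) → 1 ≤ q → 4 ≤ φ q →
    Σ ℕ λ a → Σ (List ℕ) λ as →
      1 ≤ a × a ≤ q ∸ 1 × gcd a q ≡ 1 ×
      All (1 ≤_) as × a / q ≡cf as ×
      2 ≤ length as ×
      MaybeAll.All (2 ≤_) (head as) × MaybeAll.All (2 ≤_) (last as) ×
      2 * foldr _⊔_ 0 as ≤ q ∸ 1
proposition1 q _ 4≤φq = admissible⇒goodFraction (admissible (residue q) 4≤φq)
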